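{- For every integer $n\geq 3$, $$\phi\big((C_{2n},-),\lambda\big)=\big(\phi(C_n^{1},\lambda)\big)^2,$$ where $\phi\big((C_{2n},-),\lambda\big)=\det(\lambda I-A)$ for $A$ the signed adjacency matrix of the signed cycle $(C_{2n},-)$, and $\phi(C_n^1,\lambda)=\det(\lambda I-H(C_n^1))$.
   Context: A mixed graph has undirected edges and directed edges (ordered pairs $(x,y)$). For a mixed graph $X$ with vertices $v_1,\dots,v_n$, the Hermitian adjacency matrix $H(X)$ has $(j,k)$ entry $1$ if $v_jv_k$ is an undirected edge, $i$ if $(v_j,v_k)$ is a directed edge, $-i$ if $(v_k,v_j)$ is a directed edge, and $0$ otherwise. $C_n^1$ denotes the mixed cycle of order $n$ with exactly one directed edge and all other edges undirected. A signed graph is a simple graph with each edge given a sign $\pm1$; its signed adjacency matrix has $(j,k)$ entry equal to the sign of the edge $v_jv_k$ if it exists and $0$ otherwise. $(C_{2n},-)$ denotes the cycle of order $2n$ with exactly one negative edge and all other edges positive. -}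

module Defs where

open import Data.Nat using (ℕ; zero; suc; _≡ᵇ_; _∸_)
open import Data.Integer as ℤ using (ℤ; +_; -[1+_])
open import Data.Fin using (Fin; zero; suc; toℕ; punchIn)
open import Data.List using (List; []; _∷_; map)
open import Data.Bool using (Bool; true; false; if_then_else_; _∧_)
open import Relation.Binary.PropositionalEquality using (_≡_)

-- Gaussian integers ℤ[i] (all entries of the matrices involved, and all
-- coefficients of their characteristic polynomials, lie in ℤ[i] ⊂ ℂ).

record ℤi : Set where
  constructor _+i_
  field
    re : ℤ
    im : ℤ
open ℤi public

0i 1i iI : ℤi
0i = (+ 0) +i (+ 0)
1i = (+ 1) +i (+ 0)
iI = (+ 0) +i (+ 1)

infixl 6 _⊕_
infixl 7 _⊛_

_⊕_ : ℤi → ℤi → ℤi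
(a +i b) ⊕ (c +i d) = (a ℤ.+ c) +i (b ℤ.+ d)

_⊛_ : ℤi → ℤi → ℤi
(a +i b) ⊛ (c +i d) = ((a ℤ.* c) ℤ.- (b ℤ.* d)) +i ((a ℤ.* d) ℤ.+ (b ℤ.* c))

negi : ℤi → ℤi
negi (a +i b) = (ℤ.- a) +i (ℤ.- b)

conj : ℤi → ℤi
conj (a +i b) = a +i (ℤ.- b)

-- Polynomials over ℤ[i] in the variable λ: coefficient lists, lowest
-- degree first.  Equality is coefficientwise (trailing zeros ignored).

Poly : Set
Poly = List ℤi

coeff : Poly → ℕ → ℤi
coeff []      _       = 0i
coeff (a ∷ p) zero    = a
coeff (a ∷ p) (suc k) = coeff p k

infix 4 _≈P_
_≈P_ : Poly → Poly → Set
p ≈P q = ∀ k → coeff p k ≡ coeff q k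

constP : ℤi → Poly
constP a = a ∷ []

zeroP oneP varP : Poly
zeroP = []
oneP  = constP 1i
varP  = 0i ∷ 1i ∷ []

addP : Poly → Poly → Poly
addP []      q       = q
addP (a ∷ p) []      = a ∷ p
addP (a ∷ p) (b ∷ q) = (a ⊕ b) ∷ addP p q

negP : Poly → Poly
negP = map negi

subP : Poly → Poly → Poly
subP p q = addP p (negP q)

mulP : Poly → Poly → Poly
mulP []      q = []
mulP (a ∷ p) q = addP (map (a ⊛_) q) (0i ∷ mulP p q)

sumFin : ∀ {n} → (Fin n → Poly) → Poly
sumFin {zero}  f = zeroP
sumFin {suc n} f = addP (f zero) (sumFin (λ j → f (suc j)))

signP : ℕ → Poly → Poly
signP zero          p = p
signP (suc zero)    p = negP p
signP (suc (suc k)) p = signP k p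

det : ∀ {n} → (Fin n → Fin n → Poly) → Poly
det {zero}  M = oneP
det {suc n} M =
  sumFin (λ j → signP (toℕ j)
    (mulP (M zero j) (det (λ r c → M (suc r) (punchIn j c)))))

charPoly : ∀ {n} → (Fin n → Fin n → ℤi) → Poly
charPoly {n} A =
  det (λ j k → subP (if toℕ j ≡ᵇ toℕ k then varP else zeroP) (constP (A j k)))

-- Edges v_j v_{j+1} (j < m-1) carry weight 1
-- in both directions; the closing edge gets entry w at position
-- (v_{m-1}, v_0) and conj w at (v_0, v_{m-1}).  (Meaningful for m ≥ 3.)

cycleMat : (m : ℕ) → ℤi → Fin m → Fin m → ℤi
cycleMat m w j k =
  if (toℕ k ≡ᵇ suc (toℕ j)) then 1i else
  if (toℕ j ≡ᵇ suc (toℕ k)) then 1i else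
  if ((toℕ j ≡ᵇ (m ∸ 1)) ∧ (toℕ k ≡ᵇ 0)) then w else
  if ((toℕ j ≡ᵇ 0) ∧ (toℕ k ≡ᵇ (m ∸ 1))) then conj w else 0i

-- Signed adjacency matrix of (C_{2n}, −): the closing edge v_{2n-1}v_0 is
-- the unique negative edge (entries −1 in both positions).
signedCycleNeg : (n : ℕ) → Fin (n Data.Nat.* 2) → Fin (n Data.Nat.* 2) → ℤi
signedCycleNeg n = cycleMat (n Data.Nat.* 2) (negi 1i)

-- Hermitian adjacency matrix of C_n^1: the unique directed edge is
-- (v_{n-1}, v_0), so H[n-1][0] = i and H[0][n-1] = −i.
mixedCycle1 : (n : ℕ) → Fin n → Fin n → ℤi
mixedCycle1 n = cycleMat n iI

-- Let D n be the characteristic polynomial of the path on n vertices, so that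
-- D (n + 2) = λ D (n + 1) − D n.  Expanding along the first row, the cycle on m vertices
-- whose closing edge has entries w and w̄ has characteristic polynomial
-- D m − w w̄ D (m − 2) − (w + w̄).  For (C_{2n}, −) we have w = −1, for C_n^1 we have w = i,
-- so the claim reads (D n − D (n − 2))² = D (2n) − D (2n − 2) + 2: the doubling formula
-- 2 T_{2n} = (2 T_n)² − 2 for Chebyshev polynomials, which follows from the addition formula
-- D (m + n + 2) = D (m + 1) D (n + 1) − D m D n and Cassini's identity
-- D (n + 1)² − D (n + 2) D n = 1.

module Submission where

open import Defs
open import Data.Nat using (ℕ; zero; suc; _+_; _*_; _∸_; _≡ᵇ_; _<_; _≤_; z≤n; s≤s)
open import Data.Nat.Properties using (≤-pred; +-suc)
import Data.Nat.Tactic.RingSolver as ℕ-Solver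
open import Data.Integer as ℤ using (+_)
import Data.Integer.Tactic.RingSolver as ℤ-Solver
open import Data.Bool using (true; false; if_then_else_; _∧_)
open import Data.Bool.Properties using (∧-zeroʳ)
open import Data.Fin using (Fin; zero; suc; toℕ; punchIn)
open import Data.List using ([]; _∷_; map)
open import Data.Maybe using (Maybe; nothing; just)
open import Data.Product using (_,_)
open import Relation.Binary.PropositionalEquality
open import Relation.Nullary using (yes; no)
open import Algebra using (CommutativeRing)
open import Level using (0ℓ)
import Relation.Binary.Reasoning.Setoid
open import Tactic.RingSolver using (solve-∀)
open import Tactic.RingSolver.Core.AlmostCommutativeRing using (AlmostCommutativeRing; fromCommutativeRing)

⊕-assoc : ∀ x y z → (x ⊕ y) ⊕ z ≡ x ⊕ (y ⊕ z)
⊕-assoc (a +i b) (c +i d) (e +i f) = cong₂ _+i_ (lemma a c e) (lemma b d f)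
  where lemma : ∀ a c e → (a ℤ.+ c) ℤ.+ e ≡ a ℤ.+ (c ℤ.+ e)
        lemma = ℤ-Solver.solve-∀

⊕-comm : ∀ x y → x ⊕ y ≡ y ⊕ x
⊕-comm (a +i b) (c +i d) = cong₂ _+i_ (lemma a c) (lemma b d)
  where lemma : ∀ a c → a ℤ.+ c ≡ c ℤ.+ a
        lemma = ℤ-Solver.solve-∀

⊕-identityˡ : ∀ x → 0i ⊕ x ≡ x
⊕-identityˡ (a +i b) = cong₂ _+i_ (lemma a) (lemma b)
  where lemma : ∀ a → + 0 ℤ.+ a ≡ a
        lemma = ℤ-Solver.solve-∀

⊕-identityʳ : ∀ x → x ⊕ 0i ≡ x
⊕-identityʳ x = trans (⊕-comm x 0i) (⊕-identityˡ x)

⊕-inverseˡ : ∀ x → negi x ⊕ x ≡ 0i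
⊕-inverseˡ (a +i b) = cong₂ _+i_ (lemma a) (lemma b)
  where lemma : ∀ a → ℤ.- a ℤ.+ a ≡ + 0
        lemma = ℤ-Solver.solve-∀

⊛-assoc : ∀ x y z → (x ⊛ y) ⊛ z ≡ x ⊛ (y ⊛ z)
⊛-assoc (a +i b) (c +i d) (e +i f) = cong₂ _+i_ (re-lemma a b c d e f) (im-lemma a b c d e f)
  where
  re-lemma : ∀ a b c d e f →
    (a ℤ.* c ℤ.- b ℤ.* d) ℤ.* e ℤ.- (a ℤ.* d ℤ.+ b ℤ.* c) ℤ.* f ≡
    a ℤ.* (c ℤ.* e ℤ.- d ℤ.* f) ℤ.- b ℤ.* (c ℤ.* f ℤ.+ d ℤ.* e)
  re-lemma = ℤ-Solver.solve-∀
  im-lemma : ∀ a b c d e f →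
    (a ℤ.* c ℤ.- b ℤ.* d) ℤ.* f ℤ.+ (a ℤ.* d ℤ.+ b ℤ.* c) ℤ.* e ≡
    a ℤ.* (c ℤ.* f ℤ.+ d ℤ.* e) ℤ.+ b ℤ.* (c ℤ.* e ℤ.- d ℤ.* f)
  im-lemma = ℤ-Solver.solve-∀

⊛-comm : ∀ x y → x ⊛ y ≡ y ⊛ x
⊛-comm (a +i b) (c +i d) = cong₂ _+i_ (re-lemma a b c d) (im-lemma a b c d)
  where
  re-lemma : ∀ a b c d → a ℤ.* c ℤ.- b ℤ.* d ≡ c ℤ.* a ℤ.- d ℤ.* b
  re-lemma = ℤ-Solver.solve-∀
  im-lemma : ∀ a b c d → a ℤ.* d ℤ.+ b ℤ.* c ≡ c ℤ.* b ℤ.+ d ℤ.* a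
  im-lemma = ℤ-Solver.solve-∀

⊛-identityˡ : ∀ x → 1i ⊛ x ≡ x
⊛-identityˡ (a +i b) = cong₂ _+i_ (re-lemma a b) (im-lemma a b)
  where
  re-lemma : ∀ a b → + 1 ℤ.* a ℤ.- + 0 ℤ.* b ≡ a
  re-lemma = ℤ-Solver.solve-∀
  im-lemma : ∀ a b → + 1 ℤ.* b ℤ.+ + 0 ℤ.* a ≡ b
  im-lemma = ℤ-Solver.solve-∀

⊛-zeroʳ : ∀ x → x ⊛ 0i ≡ 0i
⊛-zeroʳ (a +i b) = cong₂ _+i_ (re-lemma a b) (im-lemma a b)
  where
  re-lemma : ∀ a b → a ℤ.* + 0 ℤ.- b ℤ.* + 0 ≡ + 0
  re-lemma = ℤ-Solver.solve-∀
  im-lemma : ∀ a b → a ℤ.* + 0 ℤ.+ b ℤ.* + 0 ≡ + 0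
  im-lemma = ℤ-Solver.solve-∀

⊛-zeroˡ : ∀ x → 0i ⊛ x ≡ 0i
⊛-zeroˡ x = trans (⊛-comm 0i x) (⊛-zeroʳ x)

⊛-distribˡ-⊕ : ∀ x y z → x ⊛ (y ⊕ z) ≡ x ⊛ y ⊕ x ⊛ z
⊛-distribˡ-⊕ (a +i b) (c +i d) (e +i f) = cong₂ _+i_ (re-lemma a b c d e f) (im-lemma a b c d e f)
  where
  re-lemma : ∀ a b c d e f →
    a ℤ.* (c ℤ.+ e) ℤ.- b ℤ.* (d ℤ.+ f) ≡ (a ℤ.* c ℤ.- b ℤ.* d) ℤ.+ (a ℤ.* e ℤ.- b ℤ.* f)
  re-lemma = ℤ-Solver.solve-∀
  im-lemma : ∀ a b c d e f →
    a ℤ.* (d ℤ.+ f) ℤ.+ b ℤ.* (c ℤ.+ e) ≡ (a ℤ.* d ℤ.+ b ℤ.* c) ℤ.+ (a ℤ.* f ℤ.+ b ℤ.* e)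
  im-lemma = ℤ-Solver.solve-∀

⊕-interchange : ∀ x y z w → (x ⊕ y) ⊕ (z ⊕ w) ≡ (x ⊕ z) ⊕ (y ⊕ w)
⊕-interchange x y z w = begin
  (x ⊕ y) ⊕ (z ⊕ w) ≡⟨ ⊕-assoc x y (z ⊕ w) ⟩
  x ⊕ (y ⊕ (z ⊕ w)) ≡⟨ cong (x ⊕_) (sym (⊕-assoc y z w)) ⟩
  x ⊕ ((y ⊕ z) ⊕ w) ≡⟨ cong (λ t → x ⊕ (t ⊕ w)) (⊕-comm y z) ⟩
  x ⊕ ((z ⊕ y) ⊕ w) ≡⟨ cong (x ⊕_) (⊕-assoc z y w) ⟩
  x ⊕ (z ⊕ (y ⊕ w)) ≡⟨ sym (⊕-assoc x z (y ⊕ w)) ⟩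
  (x ⊕ z) ⊕ (y ⊕ w) ∎
  where open ≡-Reasoning

-- Polynomials over ℤ[i]

scaleP : ℤi → Poly → Poly
scaleP a = map (a ⊛_)

coeff-addP : ∀ p q k → coeff (addP p q) k ≡ coeff p k ⊕ coeff q k
coeff-addP []      q       k       = sym (⊕-identityˡ (coeff q k))
coeff-addP (a ∷ p) []      k       = sym (⊕-identityʳ (coeff (a ∷ p) k))
coeff-addP (a ∷ p) (b ∷ q) zero    = refl
coeff-addP (a ∷ p) (b ∷ q) (suc k) = coeff-addP p q k

coeff-negP : ∀ p k → coeff (negP p) k ≡ negi (coeff p k)
coeff-negP []      k       = refl
coeff-negP (a ∷ p) zero    = refl
coeff-negP (a ∷ p) (suc k) = coeff-negP p k

coeff-scaleP : ∀ a p k → coeff (scaleP a p) k ≡ a ⊛ coeff p k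
coeff-scaleP a []      k       = sym (⊛-zeroʳ a)
coeff-scaleP a (b ∷ p) zero    = refl
coeff-scaleP a (b ∷ p) (suc k) = coeff-scaleP a p k

coeff-mulP-zero : ∀ a p q → coeff (mulP (a ∷ p) q) zero ≡ a ⊛ coeff q zero
coeff-mulP-zero a p q = begin
  coeff (mulP (a ∷ p) q) zero  ≡⟨ coeff-addP (scaleP a q) (0i ∷ mulP p q) zero ⟩
  coeff (scaleP a q) zero ⊕ 0i ≡⟨ ⊕-identityʳ _ ⟩
  coeff (scaleP a q) zero      ≡⟨ coeff-scaleP a q zero ⟩
  a ⊛ coeff q zero             ∎
  where open ≡-Reasoning

coeff-mulP-suc : ∀ a p q k →
  coeff (mulP (a ∷ p) q) (suc k) ≡ a ⊛ coeff q (suc k) ⊕ coeff (mulP p q) k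
coeff-mulP-suc a p q k =
  trans (coeff-addP (scaleP a q) (0i ∷ mulP p q) (suc k))
        (cong (_⊕ coeff (mulP p q) k) (coeff-scaleP a q (suc k)))

-- A record around _≈P_, so that the two polynomials can be inferred from it.
infix 4 _≋_
record _≋_ (p q : Poly) : Set where
  constructor mk≋
  field ≋⇒≈P : p ≈P q
open _≋_ public

≋-refl : ∀ {p} → p ≋ p
≋-refl = mk≋ λ _ → refl

≋-sym : ∀ {p q} → p ≋ q → q ≋ p
≋-sym (mk≋ e) = mk≋ λ k → sym (e k)

≋-trans : ∀ {p q r} → p ≋ q → q ≋ r → p ≋ r
≋-trans (mk≋ e) (mk≋ f) = mk≋ λ k → trans (e k) (f k)

≡⇒≋ : ∀ {p q} → p ≡ q → p ≋ q
≡⇒≋ refl = ≋-refl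

addP-cong : ∀ {p p′ q q′} → p ≋ p′ → q ≋ q′ → addP p q ≋ addP p′ q′
addP-cong {p} {p′} {q} {q′} (mk≋ e) (mk≋ f) = mk≋ λ k →
  trans (coeff-addP p q k) (trans (cong₂ _⊕_ (e k) (f k)) (sym (coeff-addP p′ q′ k)))

negP-cong : ∀ {p p′} → p ≋ p′ → negP p ≋ negP p′
negP-cong {p} {p′} (mk≋ e) = mk≋ λ k →
  trans (coeff-negP p k) (trans (cong negi (e k)) (sym (coeff-negP p′ k)))

∷-cong : ∀ {a b p q} → a ≡ b → p ≋ q → a ∷ p ≋ b ∷ q
∷-cong e (mk≋ f) = mk≋ λ { zero → e ; (suc k) → f k }

scaleP-cong : ∀ a {p q} → p ≋ q → scaleP a p ≋ scaleP a q
scaleP-cong a {p} {q} (mk≋ e) = mk≋ λ k →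
  trans (coeff-scaleP a p k) (trans (cong (a ⊛_) (e k)) (sym (coeff-scaleP a q k)))

addP-assoc : ∀ p q r → addP (addP p q) r ≋ addP p (addP q r)
addP-assoc p q r = mk≋ λ k → begin
  coeff (addP (addP p q) r) k             ≡⟨ coeff-addP (addP p q) r k ⟩
  coeff (addP p q) k ⊕ coeff r k          ≡⟨ cong (_⊕ coeff r k) (coeff-addP p q k) ⟩
  coeff p k ⊕ coeff q k ⊕ coeff r k       ≡⟨ ⊕-assoc (coeff p k) (coeff q k) (coeff r k) ⟩
  coeff p k ⊕ (coeff q k ⊕ coeff r k)     ≡⟨ cong (coeff p k ⊕_) (coeff-addP q r k) ⟨
  coeff p k ⊕ coeff (addP q r) k          ≡⟨ coeff-addP p (addP q r) k ⟨
  coeff (addP p (addP q r)) k             ∎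
  where open ≡-Reasoning

addP-comm : ∀ p q → addP p q ≋ addP q p
addP-comm p q = mk≋ λ k →
  trans (coeff-addP p q k) (trans (⊕-comm (coeff p k) (coeff q k)) (sym (coeff-addP q p k)))

addP-identityʳ : ∀ p → addP p [] ≋ p
addP-identityʳ p = mk≋ λ k → trans (coeff-addP p [] k) (⊕-identityʳ (coeff p k))

negP-inverseˡ : ∀ p → addP (negP p) p ≋ []
negP-inverseˡ p = mk≋ λ k → begin
  coeff (addP (negP p) p) k         ≡⟨ coeff-addP (negP p) p k ⟩
  coeff (negP p) k ⊕ coeff p k      ≡⟨ cong (_⊕ coeff p k) (coeff-negP p k) ⟩
  negi (coeff p k) ⊕ coeff p k      ≡⟨ ⊕-inverseˡ (coeff p k) ⟩
  0i                                ∎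
  where open ≡-Reasoning

negP-inverseʳ : ∀ p → addP p (negP p) ≋ []
negP-inverseʳ p = ≋-trans (addP-comm p (negP p)) (negP-inverseˡ p)

mulP-congʳ : ∀ p {q q′} → q ≋ q′ → mulP p q ≋ mulP p q′
mulP-congʳ []      e = ≋-refl
mulP-congʳ (a ∷ p) e = addP-cong (scaleP-cong a e) (∷-cong refl (mulP-congʳ p e))

mulP-zeroʳ : ∀ p → mulP p [] ≋ []
mulP-zeroʳ []      = ≋-refl
mulP-zeroʳ (a ∷ p) = mk≋ λ { zero → refl ; (suc k) → ≋⇒≈P (mulP-zeroʳ p) k }

mulP-∷ʳ : ∀ p b q → mulP p (b ∷ q) ≋ addP (scaleP b p) (0i ∷ mulP p q)
mulP-∷ʳ p b q = mk≋ (coeffs p)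
  where
  open ≡-Reasoning
  coeffs : ∀ p k → coeff (mulP p (b ∷ q)) k ≡ coeff (addP (scaleP b p) (0i ∷ mulP p q)) k
  coeffs []      zero    = refl
  coeffs []      (suc k) = refl
  coeffs (a ∷ p) zero    = cong (_⊕ 0i) (⊛-comm a b)
  coeffs (a ∷ p) (suc k) = begin
    coeff (addP (scaleP a q) (mulP p (b ∷ q))) k
      ≡⟨ coeff-addP (scaleP a q) (mulP p (b ∷ q)) k ⟩
    x ⊕ coeff (mulP p (b ∷ q)) k
      ≡⟨ cong (x ⊕_) (trans (coeffs p k) (coeff-addP (scaleP b p) (0i ∷ mulP p q) k)) ⟩
    x ⊕ (y ⊕ z)  ≡⟨ ⊕-assoc x y z ⟨
    x ⊕ y ⊕ z    ≡⟨ cong (_⊕ z) (⊕-comm x y) ⟩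
    y ⊕ x ⊕ z    ≡⟨ ⊕-assoc y x z ⟩
    y ⊕ (x ⊕ z)  ≡⟨ cong (y ⊕_) (coeff-addP (scaleP a q) (0i ∷ mulP p q) k) ⟨
    y ⊕ coeff (mulP (a ∷ p) q) k
      ≡⟨ coeff-addP (scaleP b p) (mulP (a ∷ p) q) k ⟨
    coeff (addP (scaleP b p) (mulP (a ∷ p) q)) k
      ∎
    where x = coeff (scaleP a q) k
          y = coeff (scaleP b p) k
          z = coeff (0i ∷ mulP p q) k

mulP-comm : ∀ p q → mulP p q ≋ mulP q p
mulP-comm []      q = ≋-sym (mulP-zeroʳ q)
mulP-comm (a ∷ p) q =
  ≋-trans (addP-cong ≋-refl (∷-cong refl (mulP-comm p q))) (≋-sym (mulP-∷ʳ q a p))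

mulP-cong : ∀ {p p′ q q′} → p ≋ p′ → q ≋ q′ → mulP p q ≋ mulP p′ q′
mulP-cong {p} {p′} {q} {q′} e f =
  ≋-trans (mulP-congʳ p f) (≋-trans (mulP-comm p q′) (≋-trans (mulP-congʳ q′ e) (mulP-comm q′ p′)))

mulP-distribˡ : ∀ p q r → mulP p (addP q r) ≋ addP (mulP p q) (mulP p r)
mulP-distribˡ p q r = mk≋ (coeffs p)
  where
  open ≡-Reasoning
  coeffs : ∀ p k → coeff (mulP p (addP q r)) k ≡ coeff (addP (mulP p q) (mulP p r)) k
  coeffs []      k    = refl
  coeffs (a ∷ p) zero = begin
    coeff (mulP (a ∷ p) (addP q r)) zero
      ≡⟨ coeff-mulP-zero a p (addP q r) ⟩
    a ⊛ coeff (addP q r) zero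
      ≡⟨ cong (a ⊛_) (coeff-addP q r zero) ⟩
    a ⊛ (coeff q zero ⊕ coeff r zero)
      ≡⟨ ⊛-distribˡ-⊕ a (coeff q zero) (coeff r zero) ⟩
    a ⊛ coeff q zero ⊕ a ⊛ coeff r zero
      ≡⟨ cong₂ _⊕_ (coeff-mulP-zero a p q) (coeff-mulP-zero a p r) ⟨
    coeff (mulP (a ∷ p) q) zero ⊕ coeff (mulP (a ∷ p) r) zero
      ≡⟨ coeff-addP (mulP (a ∷ p) q) (mulP (a ∷ p) r) zero ⟨
    coeff (addP (mulP (a ∷ p) q) (mulP (a ∷ p) r)) zero
      ∎
  coeffs (a ∷ p) (suc k) = begin
    coeff (mulP (a ∷ p) (addP q r)) (suc k)
      ≡⟨ coeff-mulP-suc a p (addP q r) k ⟩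
    a ⊛ coeff (addP q r) (suc k) ⊕ coeff (mulP p (addP q r)) k
      ≡⟨ cong₂ _⊕_ (trans (cong (a ⊛_) (coeff-addP q r (suc k))) (⊛-distribˡ-⊕ a _ _))
                   (trans (coeffs p k) (coeff-addP (mulP p q) (mulP p r) k)) ⟩
    (a ⊛ coeff q (suc k) ⊕ a ⊛ coeff r (suc k)) ⊕ (coeff (mulP p q) k ⊕ coeff (mulP p r) k)
      ≡⟨ ⊕-interchange (a ⊛ coeff q (suc k)) (a ⊛ coeff r (suc k)) (coeff (mulP p q) k) (coeff (mulP p r) k) ⟩
    (a ⊛ coeff q (suc k) ⊕ coeff (mulP p q) k) ⊕ (a ⊛ coeff r (suc k) ⊕ coeff (mulP p r) k)
      ≡⟨ cong₂ _⊕_ (coeff-mulP-suc a p q k) (coeff-mulP-suc a p r k) ⟨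
    coeff (mulP (a ∷ p) q) (suc k) ⊕ coeff (mulP (a ∷ p) r) (suc k)
      ≡⟨ coeff-addP (mulP (a ∷ p) q) (mulP (a ∷ p) r) (suc k) ⟨
    coeff (addP (mulP (a ∷ p) q) (mulP (a ∷ p) r)) (suc k)
      ∎

mulP-distribʳ : ∀ p q r → mulP (addP q r) p ≋ addP (mulP q p) (mulP r p)
mulP-distribʳ p q r =
  ≋-trans (mulP-comm (addP q r) p)
    (≋-trans (mulP-distribˡ p q r) (addP-cong (mulP-comm p q) (mulP-comm p r)))

scaleP-mulP : ∀ a p q → mulP (scaleP a p) q ≋ scaleP a (mulP p q)
scaleP-mulP a p q = mk≋ (coeffs p)
  where
  open ≡-Reasoning
  coeffs : ∀ p k → coeff (mulP (scaleP a p) q) k ≡ coeff (scaleP a (mulP p q)) k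
  coeffs []      k    = refl
  coeffs (b ∷ p) zero = begin
    coeff (mulP (a ⊛ b ∷ scaleP a p) q) zero ≡⟨ coeff-mulP-zero (a ⊛ b) (scaleP a p) q ⟩
    (a ⊛ b) ⊛ coeff q zero                   ≡⟨ ⊛-assoc a b (coeff q zero) ⟩
    a ⊛ (b ⊛ coeff q zero)                   ≡⟨ cong (a ⊛_) (coeff-mulP-zero b p q) ⟨
    a ⊛ coeff (mulP (b ∷ p) q) zero          ≡⟨ coeff-scaleP a (mulP (b ∷ p) q) zero ⟨
    coeff (scaleP a (mulP (b ∷ p) q)) zero   ∎
  coeffs (b ∷ p) (suc k) = begin
    coeff (mulP (a ⊛ b ∷ scaleP a p) q) (suc k)
      ≡⟨ coeff-mulP-suc (a ⊛ b) (scaleP a p) q k ⟩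
    (a ⊛ b) ⊛ coeff q (suc k) ⊕ coeff (mulP (scaleP a p) q) k
      ≡⟨ cong₂ _⊕_ (⊛-assoc a b (coeff q (suc k))) (trans (coeffs p k) (coeff-scaleP a (mulP p q) k)) ⟩
    a ⊛ (b ⊛ coeff q (suc k)) ⊕ a ⊛ coeff (mulP p q) k
      ≡⟨ ⊛-distribˡ-⊕ a (b ⊛ coeff q (suc k)) (coeff (mulP p q) k) ⟨
    a ⊛ (b ⊛ coeff q (suc k) ⊕ coeff (mulP p q) k)
      ≡⟨ cong (a ⊛_) (coeff-mulP-suc b p q k) ⟨
    a ⊛ coeff (mulP (b ∷ p) q) (suc k)
      ≡⟨ coeff-scaleP a (mulP (b ∷ p) q) (suc k) ⟨
    coeff (scaleP a (mulP (b ∷ p) q)) (suc k)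
      ∎

0∷-mulP : ∀ p q → mulP (0i ∷ p) q ≋ 0i ∷ mulP p q
0∷-mulP p q = mk≋ λ
  { zero    → trans (coeff-mulP-zero 0i p q) (⊛-zeroˡ (coeff q zero))
  ; (suc k) → trans (coeff-mulP-suc 0i p q k)
                (trans (cong (_⊕ coeff (mulP p q) k) (⊛-zeroˡ (coeff q (suc k))))
                       (⊕-identityˡ (coeff (mulP p q) k)))
  }

mulP-assoc : ∀ p q r → mulP (mulP p q) r ≋ mulP p (mulP q r)
mulP-assoc []      q r = ≋-refl
mulP-assoc (a ∷ p) q r =
  ≋-trans (mulP-distribʳ r (scaleP a q) (0i ∷ mulP p q))
    (addP-cong (scaleP-mulP a q r)
               (≋-trans (0∷-mulP (mulP p q) r) (∷-cong refl (mulP-assoc p q r))))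

mulP-identityˡ : ∀ p → mulP oneP p ≋ p
mulP-identityˡ p = mk≋ λ k → begin
  coeff (addP (scaleP 1i p) (0i ∷ [])) k     ≡⟨ coeff-addP (scaleP 1i p) (0i ∷ []) k ⟩
  coeff (scaleP 1i p) k ⊕ coeff (0i ∷ []) k  ≡⟨ cong₂ _⊕_ (coeff-scaleP 1i p k) (coeff-0∷[] k) ⟩
  1i ⊛ coeff p k ⊕ 0i                        ≡⟨ ⊕-identityʳ _ ⟩
  1i ⊛ coeff p k                             ≡⟨ ⊛-identityˡ (coeff p k) ⟩
  coeff p k                                  ∎
  where
  open ≡-Reasoning
  coeff-0∷[] : ∀ k → coeff (0i ∷ []) k ≡ 0i
  coeff-0∷[] zero    = refl
  coeff-0∷[] (suc k) = refl

mulP-identityʳ : ∀ p → mulP p oneP ≋ p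
mulP-identityʳ p = ≋-trans (mulP-comm p oneP) (mulP-identityˡ p)

poly-commutativeRing : CommutativeRing 0ℓ 0ℓ
poly-commutativeRing = record
  { Carrier = Poly ; _≈_ = _≋_ ; _+_ = addP ; _*_ = mulP ; -_ = negP ; 0# = zeroP ; 1# = oneP
  ; isCommutativeRing = record
    { isRing = record
      { +-isAbelianGroup = record
        { isGroup = record
          { isMonoid = record
            { isSemigroup = record
              { isMagma = record
                { isEquivalence = record { refl = ≋-refl ; sym = ≋-sym ; trans = ≋-trans }
                ; ∙-cong = addP-cong }
              ; assoc = addP-assoc }
            ; identity = (λ _ → ≋-refl) , addP-identityʳ }
          ; inverse = negP-inverseˡ , negP-inverseʳ
          ; ⁻¹-cong = negP-cong }
        ; comm = addP-comm }
      ; *-cong = mulP-cong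
      ; *-assoc = mulP-assoc
      ; *-identity = mulP-identityˡ , mulP-identityʳ
      ; distrib = mulP-distribˡ , mulP-distribʳ }
    ; *-comm = mulP-comm } }

isZero? : ∀ p → Maybe (zeroP ≋ p)
isZero? []             = just ≋-refl
isZero? ((a +i b) ∷ p) with a ℤ.≟ + 0 | b ℤ.≟ + 0 | isZero? p
... | yes refl | yes refl | just (mk≋ e) = just (mk≋ λ { zero → refl ; (suc k) → e k })
... | _        | _        | _            = nothing

poly-ring : AlmostCommutativeRing 0ℓ 0ℓ
poly-ring = fromCommutativeRing poly-commutativeRing isZero?

infixl 6 _+P_ _-P_
infixl 7 _*P_
infix  8 -P_

_+P_ _-P_ _*P_ : Poly → Poly → Poly
_+P_ = addP
_-P_ = subP
_*P_ = mulP

-P_ : Poly → Poly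
-P_ = negP

module ≋-Reasoning = Relation.Binary.Reasoning.Setoid (CommutativeRing.setoid poly-commutativeRing)

negP-involutive : ∀ x → -P -P x ≋ x
negP-involutive = solve-∀ poly-ring

signP-cong : ∀ k {x y} → x ≋ y → signP k x ≋ signP k y
signP-cong zero          e = e
signP-cong (suc zero)    e = negP-cong e
signP-cong (suc (suc k)) e = signP-cong k e

signP-≋-mulP : ∀ k x → signP k x ≋ signP k oneP *P x
signP-≋-mulP zero          x = ≋-sym (mulP-identityˡ x)
signP-≋-mulP (suc zero)    x = lemma x
  where lemma : ∀ x → -P x ≋ -P oneP *P x
        lemma = solve-∀ poly-ring
signP-≋-mulP (suc (suc k)) x = signP-≋-mulP k x

signP-suc : ∀ k x → signP (suc k) x ≋ -P signP k x
signP-suc zero          x = ≋-refl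
signP-suc (suc zero)    x = ≋-sym (negP-involutive x)
signP-suc (suc (suc k)) x = signP-suc k x

signP-square : ∀ k → signP k oneP *P signP k oneP ≋ oneP
signP-square zero          = mulP-identityˡ oneP
signP-square (suc zero)    = mk≋ λ { zero → refl ; (suc zero) → refl ; (suc (suc k)) → refl }
signP-square (suc (suc k)) = signP-square k

signP-involutive : ∀ k x → signP k (signP k x) ≋ x
signP-involutive zero          x = ≋-refl
signP-involutive (suc zero)    x = negP-involutive x
signP-involutive (suc (suc k)) x = signP-involutive k x

signP-+ : ∀ k x y → signP k (x +P y) ≋ signP k x +P signP k y
signP-+ zero          x y = ≋-refl
signP-+ (suc zero)    x y = lemma x y
  where lemma : ∀ x y → -P (x +P y) ≋ -P x +P -P y
        lemma = solve-∀ poly-ring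
signP-+ (suc (suc k)) x y = signP-+ k x y

signP-zero : ∀ k → signP k zeroP ≋ zeroP
signP-zero zero          = ≋-refl
signP-zero (suc zero)    = ≋-refl
signP-zero (suc (suc k)) = signP-zero k

sumℕ : ℕ → (ℕ → Poly) → Poly
sumℕ zero    f = zeroP
sumℕ (suc n) f = f 0 +P sumℕ n (λ j → f (suc j))

sumℕ-cong : ∀ n {f g} → (∀ j → j < n → f j ≋ g j) → sumℕ n f ≋ sumℕ n g
sumℕ-cong zero    e = ≋-refl
sumℕ-cong (suc n) e = addP-cong (e 0 (s≤s z≤n)) (sumℕ-cong n (λ j j<n → e (suc j) (s≤s j<n)))

sumℕ-zero : ∀ n {f} → (∀ j → j < n → f j ≋ zeroP) → sumℕ n f ≋ zeroP
sumℕ-zero zero    e = ≋-refl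
sumℕ-zero (suc n) e = addP-cong (e 0 (s≤s z≤n)) (sumℕ-zero n (λ j j<n → e (suc j) (s≤s j<n)))

sumℕ-suc : ∀ n f → sumℕ (suc n) f ≋ sumℕ n f +P f n
sumℕ-suc zero    f = addP-identityʳ (f 0)
sumℕ-suc (suc n) f =
  ≋-trans (addP-cong (≋-refl {f 0}) (sumℕ-suc n (λ j → f (suc j))))
          (≋-sym (addP-assoc (f 0) (sumℕ n (λ j → f (suc j))) (f (suc n))))

sumℕ-+ : ∀ n f g → sumℕ n (λ j → f j +P g j) ≋ sumℕ n f +P sumℕ n g
sumℕ-+ zero    f g = ≋-refl
sumℕ-+ (suc n) f g =
  ≋-trans (addP-cong ≋-refl (sumℕ-+ n (λ j → f (suc j)) (λ j → g (suc j))))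
          (interchange (f 0) (g 0) (sumℕ n (λ j → f (suc j))) (sumℕ n (λ j → g (suc j))))
  where interchange : ∀ a b c d → (a +P b) +P (c +P d) ≋ (a +P c) +P (b +P d)
        interchange = solve-∀ poly-ring

signP-sumℕ : ∀ k n f → signP k (sumℕ n f) ≋ sumℕ n (λ j → signP k (f j))
signP-sumℕ k zero    f = signP-zero k
signP-sumℕ k (suc n) f =
  ≋-trans (signP-+ k (f 0) _) (addP-cong ≋-refl (signP-sumℕ k n (λ j → f (suc j))))

-- Determinants of ℕ-indexed matrices

Matrix : Set
Matrix = ℕ → ℕ → Poly

punchInℕ : ℕ → ℕ → ℕ
punchInℕ zero    c       = suc c
punchInℕ (suc j) zero    = zero
punchInℕ (suc j) (suc c) = suc (punchInℕ j c)

minorℕ : Matrix → ℕ → Matrix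
minorℕ f j r c = f (suc r) (punchInℕ j c)

-- detℕ n f only reads the top-left n × n block of f.
detℕ : ℕ → Matrix → Poly
laplaceTerm : ℕ → Matrix → ℕ → Poly

detℕ zero    f = oneP
detℕ (suc n) f = sumℕ (suc n) (laplaceTerm n f)

laplaceTerm n f j = signP j (f 0 j *P detℕ n (minorℕ f j))

punchInℕ-< : ∀ {n j c} → j < suc n → c < n → punchInℕ j c < suc n
punchInℕ-< {n}     {zero}  {c}     _         c<n       = s≤s c<n
punchInℕ-< {n}     {suc j} {zero}  _         _         = s≤s z≤n
punchInℕ-< {suc n} {suc j} {suc c} (s≤s j<) (s≤s c<n) = s≤s (punchInℕ-< j< c<n)

detℕ-cong : ∀ n {f g} → (∀ r c → r < n → c < n → f r c ≋ g r c) → detℕ n f ≋ detℕ n g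
detℕ-cong zero    e = ≋-refl
detℕ-cong (suc n) e = sumℕ-cong (suc n) λ j j< →
  signP-cong j (mulP-cong (e 0 j (s≤s z≤n) j<)
    (detℕ-cong n (λ r c r< c< → e (suc r) (punchInℕ j c) (s≤s r<) (punchInℕ-< j< c<))))

detℕ-cong′ : ∀ n {f g} → (∀ r c → f r c ≋ g r c) → detℕ n f ≋ detℕ n g
detℕ-cong′ n e = detℕ-cong n (λ r c _ _ → e r c)

sumFin-cong : ∀ {n} {f g : Fin n → Poly} → (∀ j → f j ≡ g j) → sumFin f ≡ sumFin g
sumFin-cong {zero}  e = refl
sumFin-cong {suc n} e = cong₂ addP (e zero) (sumFin-cong (λ j → e (suc j)))

sumFin-toℕ : ∀ n (f : ℕ → Poly) → sumFin {n} (λ j → f (toℕ j)) ≡ sumℕ n f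
sumFin-toℕ zero    f = refl
sumFin-toℕ (suc n) f = cong (addP (f 0)) (sumFin-toℕ n (λ j → f (suc j)))

det-cong : ∀ {n} {M N : Fin n → Fin n → Poly} → (∀ r c → M r c ≡ N r c) → det M ≡ det N
det-cong {zero}  e = refl
det-cong {suc n} e = sumFin-cong λ j →
  cong (signP (toℕ j)) (cong₂ mulP (e zero j) (det-cong (λ r c → e (suc r) (punchIn j c))))

toℕ-punchIn : ∀ {n} (j : Fin (suc n)) (c : Fin n) → toℕ (punchIn j c) ≡ punchInℕ (toℕ j) (toℕ c)
toℕ-punchIn zero    c       = refl
toℕ-punchIn (suc j) zero    = refl
toℕ-punchIn (suc j) (suc c) = cong suc (toℕ-punchIn j c)

det-toℕ : ∀ n (f : Matrix) → det {n} (λ r c → f (toℕ r) (toℕ c)) ≡ detℕ n f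
det-toℕ zero    f = refl
det-toℕ (suc n) f = trans
  (sumFin-cong {suc n} λ j → cong (λ d → signP (toℕ j) (f 0 (toℕ j) *P d)) (begin
    det {n} (λ r c → f (suc (toℕ r)) (toℕ (punchIn j c)))
      ≡⟨ det-cong (λ r c → cong (f (suc (toℕ r))) (toℕ-punchIn j c)) ⟩
    det {n} (λ r c → minorℕ f (toℕ j) (toℕ r) (toℕ c))
      ≡⟨ det-toℕ n (minorℕ f (toℕ j)) ⟩
    detℕ n (minorℕ f (toℕ j))
      ∎))
  (sumFin-toℕ (suc n) (laplaceTerm n f))
  where open ≡-Reasoning

laplaceTerm-entry-zero : ∀ n f j → f 0 j ≋ zeroP → laplaceTerm n f j ≋ zeroP
laplaceTerm-entry-zero n f j z = ≋-trans (signP-cong j (mulP-cong z ≋-refl)) (signP-zero j)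

laplaceTerm-minor-zero : ∀ n f j → detℕ n (minorℕ f j) ≋ zeroP → laplaceTerm n f j ≋ zeroP
laplaceTerm-minor-zero n f j z =
  ≋-trans (signP-cong j (≋-trans (mulP-congʳ (f 0 j) z) (mulP-zeroʳ (f 0 j)))) (signP-zero j)

detℕ-column₀-zero : ∀ n f → (∀ r → f r 0 ≋ zeroP) → detℕ (suc n) f ≋ zeroP
detℕ-column₀-zero zero    f z = addP-cong (laplaceTerm-entry-zero 0 f 0 (z 0)) ≋-refl
detℕ-column₀-zero (suc n) f z = sumℕ-zero (suc (suc n)) term-zero
  where
  term-zero : ∀ j → j < suc (suc n) → laplaceTerm (suc n) f j ≋ zeroP
  term-zero zero    _ = laplaceTerm-entry-zero (suc n) f 0 (z 0)
  term-zero (suc j) _ = laplaceTerm-minor-zero (suc n) f (suc j)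
    (detℕ-column₀-zero n (minorℕ f (suc j)) (λ r → z (suc r)))

detℕ-column₀-top : ∀ n f → (∀ r → f (suc r) 0 ≋ zeroP) →
  detℕ (suc n) f ≋ f 0 0 *P detℕ n (minorℕ f 0)
detℕ-column₀-top zero    f z = addP-identityʳ _
detℕ-column₀-top (suc n) f z =
  ≋-trans (addP-cong (≋-refl {laplaceTerm (suc n) f 0}) (sumℕ-zero (suc n) term-zero))
          (addP-identityʳ _)
  where
  term-zero : ∀ j → j < suc n → laplaceTerm (suc n) f (suc j) ≋ zeroP
  term-zero j _ = laplaceTerm-minor-zero (suc n) f (suc j) (detℕ-column₀-zero n (minorℕ f (suc j)) z)

detℕ-row₀-two-entries : ∀ n f → (∀ j → f 0 (suc (suc j)) ≋ zeroP) →
  detℕ (suc (suc n)) f ≋ f 0 0 *P detℕ (suc n) (minorℕ f 0) -P f 0 1 *P detℕ (suc n) (minorℕ f 1)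
detℕ-row₀-two-entries n f z =
  addP-cong (≋-refl {laplaceTerm (suc n) f 0})
    (≋-trans (addP-cong (≋-refl {laplaceTerm (suc n) f 1})
                        (sumℕ-zero n (λ j _ → laplaceTerm-entry-zero (suc n) f (suc (suc j)) (z j))))
             (addP-identityʳ _))

detℕ-column₀-linear : ∀ n f g h →
  (∀ r → f r 0 ≋ g r 0 +P h r 0) →
  (∀ r c → f r (suc c) ≋ g r (suc c)) → (∀ r c → f r (suc c) ≋ h r (suc c)) →
  detℕ (suc n) f ≋ detℕ (suc n) g +P detℕ (suc n) h
laplaceTerm-column₀-linear : ∀ n f g h →
  (∀ r → f r 0 ≋ g r 0 +P h r 0) →
  (∀ r c → f r (suc c) ≋ g r (suc c)) → (∀ r c → f r (suc c) ≋ h r (suc c)) →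
  ∀ j → j < suc n → laplaceTerm n f j ≋ laplaceTerm n g j +P laplaceTerm n h j

detℕ-column₀-linear n f g h col₀ colg colh = ≋-trans
  (sumℕ-cong (suc n) (laplaceTerm-column₀-linear n f g h col₀ colg colh))
  (sumℕ-+ (suc n) (laplaceTerm n g) (laplaceTerm n h))

laplaceTerm-column₀-linear n f g h col₀ colg colh zero _ = ≋-trans
  (mulP-cong (col₀ 0) ≋-refl)
  (≋-trans (mulP-distribʳ _ (g 0 0) (h 0 0))
    (addP-cong (mulP-congʳ (g 0 0) (detℕ-cong′ n (λ r c → colg (suc r) c)))
               (mulP-congʳ (h 0 0) (detℕ-cong′ n (λ r c → colh (suc r) c)))))
laplaceTerm-column₀-linear (suc n) f g h col₀ colg colh (suc j) _ = ≋-trans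
  (signP-cong (suc j) (≋-trans
    (mulP-congʳ (f 0 (suc j))
      (detℕ-column₀-linear n (minorℕ f (suc j)) (minorℕ g (suc j)) (minorℕ h (suc j))
        (λ r → col₀ (suc r)) (λ r c → colg (suc r) (punchInℕ j c)) (λ r c → colh (suc r) (punchInℕ j c))))
    (≋-trans (mulP-distribˡ (f 0 (suc j)) _ _)
             (addP-cong (mulP-cong (colg 0 j) ≋-refl) (mulP-cong (colh 0 j) ≋-refl)))))
  (signP-+ (suc j) _ _)
laplaceTerm-column₀-linear zero f g h col₀ colg colh (suc j) (s≤s ())

≡ᵇ-refl : ∀ n → (n ≡ᵇ n) ≡ true
≡ᵇ-refl zero    = refl
≡ᵇ-refl (suc n) = ≡ᵇ-refl n

≡ᵇ-true⇒≡ : ∀ {n m} → (n ≡ᵇ m) ≡ true → n ≡ m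
≡ᵇ-true⇒≡ {zero}  {zero}  _ = refl
≡ᵇ-true⇒≡ {suc n} {suc m} e = cong suc (≡ᵇ-true⇒≡ e)

if-≡ᵇ-irrelevant : ∀ n m (f : ℕ → Poly) → (if n ≡ᵇ m then f m else f n) ≋ f n
if-≡ᵇ-irrelevant n m f with n ≡ᵇ m in eq
... | true  = ≡⇒≋ (cong f (sym (≡ᵇ-true⇒≡ eq)))
... | false = ≋-refl

<⇒≡ᵇ-false : ∀ {c n} → c < n → (c ≡ᵇ n) ≡ false
<⇒≡ᵇ-false {zero}  {suc n} _         = refl
<⇒≡ᵇ-false {suc c} {suc n} (s≤s c<n) = <⇒≡ᵇ-false c<n

punchInℕ-below : ∀ {j c} → c < j → punchInℕ j c ≡ c
punchInℕ-below {suc j} {zero}  _         = refl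
punchInℕ-below {suc j} {suc c} (s≤s c<j) = cong suc (punchInℕ-below c<j)

punchInℕ-≡ᵇ-suc : ∀ j c L → j ≤ L → c ≤ L → (punchInℕ j c ≡ᵇ suc L) ≡ (c ≡ᵇ L)
punchInℕ-≡ᵇ-suc zero    c       L       _         _         = refl
punchInℕ-≡ᵇ-suc (suc j) zero    (suc L) _         _         = refl
punchInℕ-≡ᵇ-suc (suc j) (suc c) (suc L) (s≤s j≤L) (s≤s c≤L) = punchInℕ-≡ᵇ-suc j c L j≤L c≤L

rotateColumns : ℕ → Matrix → Matrix
rotateColumns L f r c = if c ≡ᵇ L then f r 0 else f r (suc c)

detℕ-rotateColumns : ∀ L f → detℕ (suc L) (rotateColumns L f) ≋ signP L (detℕ (suc L) f)
detℕ-rotateColumns zero    f = ≋-refl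
detℕ-rotateColumns (suc L) f = begin
  sumℕ (suc (suc L)) (laplaceTerm (suc L) g)
    ≈⟨ sumℕ-suc (suc L) (laplaceTerm (suc L) g) ⟩
  sumℕ (suc L) (laplaceTerm (suc L) g) +P laplaceTerm (suc L) g (suc L)
    ≈⟨ addP-cong (sumℕ-cong (suc L) inner-term) last-term ⟩
  sumℕ (suc L) (λ j → signP (suc L) (laplaceTerm (suc L) f (suc j))) +P signP (suc L) (laplaceTerm (suc L) f 0)
    ≈⟨ addP-cong (signP-sumℕ (suc L) (suc L) (λ j → laplaceTerm (suc L) f (suc j))) ≋-refl ⟨
  signP (suc L) (sumℕ (suc L) (λ j → laplaceTerm (suc L) f (suc j))) +P signP (suc L) (laplaceTerm (suc L) f 0)
    ≈⟨ signP-+ (suc L) _ _ ⟨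
  signP (suc L) (sumℕ (suc L) (λ j → laplaceTerm (suc L) f (suc j)) +P laplaceTerm (suc L) f 0)
    ≈⟨ signP-cong (suc L) (addP-comm (sumℕ (suc L) (λ j → laplaceTerm (suc L) f (suc j))) (laplaceTerm (suc L) f 0)) ⟩
  signP (suc L) (detℕ (suc (suc L)) f)
    ∎
  where
  open ≋-Reasoning
  g = rotateColumns (suc L) f

  minor-inner : ∀ j r c → j ≤ L → c ≤ L →
    minorℕ g j r c ≋ rotateColumns L (minorℕ f (suc j)) r c
  minor-inner j r c j≤L c≤L rewrite punchInℕ-≡ᵇ-suc j c L j≤L c≤L = ≋-refl

  minor-last : ∀ r c → c < suc L → minorℕ g (suc L) r c ≋ minorℕ f 0 r c
  minor-last r c c<sL rewrite punchInℕ-below c<sL | <⇒≡ᵇ-false c<sL = ≋-refl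

  signs : ∀ σj σL a M → σj *P (a *P (σL *P M)) ≋ -P σL *P (-P σj *P (a *P M))
  signs = solve-∀ poly-ring

  inner-term : ∀ j → j < suc L → laplaceTerm (suc L) g j ≋ signP (suc L) (laplaceTerm (suc L) f (suc j))
  inner-term j j<sL rewrite <⇒≡ᵇ-false j<sL = begin
    signP j (a *P detℕ (suc L) (minorℕ g j))
      ≈⟨ signP-cong j (mulP-congʳ a (detℕ-cong (suc L) (λ r c _ c<sL →
           minor-inner j r c (≤-pred j<sL) (≤-pred c<sL)))) ⟩
    signP j (a *P detℕ (suc L) (rotateColumns L (minorℕ f (suc j))))
      ≈⟨ signP-cong j (mulP-congʳ a (detℕ-rotateColumns L (minorℕ f (suc j)))) ⟩
    signP j (a *P signP L M)
      ≈⟨ signP-≋-mulP j _ ⟩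
    signP j oneP *P (a *P signP L M)
      ≈⟨ mulP-congʳ (signP j oneP) (mulP-congʳ a (signP-≋-mulP L M)) ⟩
    signP j oneP *P (a *P (signP L oneP *P M))
      ≈⟨ signs (signP j oneP) (signP L oneP) a M ⟩
    -P signP L oneP *P (-P signP j oneP *P (a *P M))
      ≈⟨ mulP-cong (signP-suc L oneP) (mulP-cong (signP-suc j oneP) ≋-refl) ⟨
    signP (suc L) oneP *P (signP (suc j) oneP *P (a *P M))
      ≈⟨ mulP-congʳ (signP (suc L) oneP) (signP-≋-mulP (suc j) (a *P M)) ⟨
    signP (suc L) oneP *P signP (suc j) (a *P M)
      ≈⟨ signP-≋-mulP (suc L) _ ⟨
    signP (suc L) (signP (suc j) (a *P M))
      ∎
    where a = f 0 (suc j)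
          M = detℕ (suc L) (minorℕ f (suc j))

  last-term : laplaceTerm (suc L) g (suc L) ≋ signP (suc L) (laplaceTerm (suc L) f 0)
  last-term rewrite ≡ᵇ-refl L =
    signP-cong (suc L) (mulP-congʳ (f 0 0) (detℕ-cong (suc L) (λ r c _ c<sL → minor-last r c c<sL)))

-- Path polynomials

-- λI − A for the adjacency matrix A of the one-way infinite path 0 − 1 − 2 − ⋯
tridiag : Matrix
tridiag r c = (if r ≡ᵇ c then varP else zeroP) -P (if c ≡ᵇ suc r then oneP else if r ≡ᵇ suc c then oneP else zeroP)

pathPoly : ℕ → Poly
pathPoly n = detℕ n tridiag

pathPoly-1 : pathPoly 1 ≋ varP
pathPoly-1 = ≋-trans (addP-identityʳ _) (mulP-identityʳ varP)

pathPoly-suc-suc : ∀ n → pathPoly (suc (suc n)) ≋ varP *P pathPoly (suc n) -P pathPoly n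
pathPoly-suc-suc n = begin
  pathPoly (suc (suc n))
    ≈⟨ detℕ-row₀-two-entries n tridiag (λ _ → ≋-refl) ⟩
  varP *P pathPoly (suc n) -P -P oneP *P detℕ (suc n) (minorℕ tridiag 1)
    ≈⟨ addP-cong ≋-refl (negP-cong (mulP-congʳ (-P oneP) (detℕ-column₀-top n (minorℕ tridiag 1) (λ _ → ≋-refl)))) ⟩
  varP *P pathPoly (suc n) -P -P oneP *P (-P oneP *P pathPoly n)
    ≈⟨ signs varP (pathPoly (suc n)) (pathPoly n) ⟩
  varP *P pathPoly (suc n) -P pathPoly n
    ∎
  where
  open ≋-Reasoning
  signs : ∀ t a b → t *P a -P -P oneP *P (-P oneP *P b) ≋ t *P a -P b
  signs = solve-∀ poly-ring

pathPoly-+ : ∀ m n →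
  pathPoly (suc (suc (m + n))) ≋ pathPoly (suc m) *P pathPoly (suc n) -P pathPoly m *P pathPoly n
pathPoly-+ zero n = ≋-trans (pathPoly-suc-suc n)
  (≋-sym (addP-cong (mulP-cong pathPoly-1 ≋-refl) (negP-cong (mulP-identityˡ (pathPoly n)))))
pathPoly-+ (suc m) n = begin
  pathPoly (suc (suc (suc (m + n))))
    ≡⟨ cong (λ k → pathPoly (suc (suc k))) (+-suc m n) ⟨
  pathPoly (suc (suc (m + suc n)))
    ≈⟨ pathPoly-+ m (suc n) ⟩
  pathPoly (suc m) *P pathPoly (suc (suc n)) -P pathPoly m *P pathPoly (suc n)
    ≈⟨ addP-cong (mulP-congʳ (pathPoly (suc m)) (pathPoly-suc-suc n)) ≋-refl ⟩
  pathPoly (suc m) *P (varP *P pathPoly (suc n) -P pathPoly n) -P pathPoly m *P pathPoly (suc n)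
    ≈⟨ regroup varP (pathPoly (suc m)) (pathPoly m) (pathPoly (suc n)) (pathPoly n) ⟩
  (varP *P pathPoly (suc m) -P pathPoly m) *P pathPoly (suc n) -P pathPoly (suc m) *P pathPoly n
    ≈⟨ addP-cong (mulP-cong (pathPoly-suc-suc m) ≋-refl) ≋-refl ⟨
  pathPoly (suc (suc m)) *P pathPoly (suc n) -P pathPoly (suc m) *P pathPoly n
    ∎
  where
  open ≋-Reasoning
  regroup : ∀ t a b c d → a *P (t *P c -P d) -P b *P c ≋ (t *P a -P b) *P c -P a *P d
  regroup = solve-∀ poly-ring

pathPoly-cassini : ∀ n →
  pathPoly (suc n) *P pathPoly (suc n) -P pathPoly (suc (suc n)) *P pathPoly n ≋ oneP
pathPoly-cassini zero = begin
  pathPoly 1 *P pathPoly 1 -P pathPoly 2 *P oneP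
    ≈⟨ addP-cong (mulP-cong pathPoly-1 pathPoly-1) (negP-cong (mulP-cong (pathPoly-suc-suc 0) (≋-refl {oneP}))) ⟩
  varP *P varP -P (varP *P pathPoly 1 -P oneP) *P oneP
    ≈⟨ addP-cong (≋-refl {varP *P varP}) (negP-cong (mulP-cong (addP-cong (mulP-congʳ varP pathPoly-1) (≋-refl { -P oneP})) (≋-refl {oneP}))) ⟩
  varP *P varP -P (varP *P varP -P oneP) *P oneP
    ≈⟨ identity varP ⟩
  oneP
    ∎
  where
  open ≋-Reasoning
  identity : ∀ t → t *P t -P (t *P t -P oneP) *P oneP ≋ oneP
  identity = solve-∀ poly-ring
pathPoly-cassini (suc n) = begin
  c *P c -P pathPoly (suc (suc (suc n))) *P a
    ≈⟨ addP-cong (mulP-cong c≋ c≋) (negP-cong (mulP-cong (pathPoly-suc-suc (suc n)) ≋-refl)) ⟩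
  (varP *P a -P b) *P (varP *P a -P b) -P (varP *P c -P a) *P a
    ≈⟨ addP-cong ≋-refl (negP-cong (mulP-cong (addP-cong (mulP-congʳ varP c≋) ≋-refl) ≋-refl)) ⟩
  (varP *P a -P b) *P (varP *P a -P b) -P (varP *P (varP *P a -P b) -P a) *P a
    ≈⟨ identity varP a b ⟩
  a *P a -P (varP *P a -P b) *P b
    ≈⟨ addP-cong ≋-refl (negP-cong (mulP-cong c≋ ≋-refl)) ⟨
  a *P a -P c *P b
    ≈⟨ pathPoly-cassini n ⟩
  oneP
    ∎
  where
  open ≋-Reasoning
  a = pathPoly (suc n)
  b = pathPoly n
  c = pathPoly (suc (suc n))
  c≋ : c ≋ varP *P a -P b
  c≋ = pathPoly-suc-suc n
  identity : ∀ t a b →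
    (t *P a -P b) *P (t *P a -P b) -P (t *P (t *P a -P b) -P a) *P a ≋ a *P a -P (t *P a -P b) *P b
  identity = solve-∀ poly-ring

withColumn : ℕ → (ℕ → Poly) → Matrix → Matrix
withColumn L v f r c = if c ≡ᵇ L then v r else f r c

unitColumn : Poly → ℕ → ℕ → Poly
unitColumn x K r = if r ≡ᵇ K then x else zeroP

shiftedTridiag : Matrix
shiftedTridiag r c = tridiag (suc r) c

detℕ-tridiag-unitColumn₀ : ∀ x K → detℕ (suc K) (withColumn 0 (unitColumn x K) tridiag) ≋ x
detℕ-tridiag-unitColumn₀ x zero    = ≋-trans (addP-identityʳ _) (mulP-identityʳ x)
detℕ-tridiag-unitColumn₀ x (suc K) = begin
  detℕ (suc (suc K)) (withColumn 0 (unitColumn x (suc K)) tridiag)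
    ≈⟨ detℕ-row₀-two-entries K (withColumn 0 (unitColumn x (suc K)) tridiag) (λ _ → ≋-refl) ⟩
  zeroP -P -P oneP *P detℕ (suc K) (minorℕ (withColumn 0 (unitColumn x (suc K)) tridiag) 1)
    ≈⟨ addP-cong (≋-refl {zeroP}) (negP-cong (mulP-congʳ (-P oneP) (detℕ-cong′ (suc K) minor≋))) ⟩
  zeroP -P -P oneP *P detℕ (suc K) (withColumn 0 (unitColumn x K) tridiag)
    ≈⟨ addP-cong (≋-refl {zeroP}) (negP-cong (mulP-congʳ (-P oneP) (detℕ-tridiag-unitColumn₀ x K))) ⟩
  zeroP -P -P oneP *P x
    ≈⟨ signs x ⟩
  x ∎
  where
  open ≋-Reasoning
  minor≋ : ∀ r c → minorℕ (withColumn 0 (unitColumn x (suc K)) tridiag) 1 r c ≋ withColumn 0 (unitColumn x K) tridiag r c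
  minor≋ r zero    = ≋-refl
  minor≋ r (suc c) = ≋-refl
  signs : ∀ x → zeroP -P -P oneP *P x ≋ x
  signs = solve-∀ poly-ring

detℕ-tridiag-unitColumnLast : ∀ x L → detℕ (suc L) (withColumn L (unitColumn x L) tridiag) ≋ x *P pathPoly L
detℕ-tridiag-unitColumnLast x zero          = addP-identityʳ _
detℕ-tridiag-unitColumnLast x (suc zero)    = begin
  detℕ 2 (withColumn 1 (unitColumn x 1) tridiag)
    ≈⟨ detℕ-row₀-two-entries 0 (withColumn 1 (unitColumn x 1) tridiag) (λ _ → ≋-refl) ⟩
  varP *P detℕ 1 (withColumn 0 (unitColumn x 0) tridiag) -P zeroP *P d
    ≈⟨ addP-cong (mulP-congʳ varP (detℕ-tridiag-unitColumnLast x zero)) (≋-refl { -P (zeroP *P d)}) ⟩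
  varP *P (x *P oneP) -P zeroP *P d
    ≈⟨ identity varP x d ⟩
  x *P varP
    ≈⟨ mulP-congʳ x pathPoly-1 ⟨
  x *P pathPoly 1 ∎
  where
  open ≋-Reasoning
  d = detℕ 1 (minorℕ (withColumn 1 (unitColumn x 1) tridiag) 1)
  identity : ∀ t x d → t *P (x *P oneP) -P zeroP *P d ≋ x *P t
  identity = solve-∀ poly-ring
detℕ-tridiag-unitColumnLast x (suc (suc L)) = begin
  detℕ (suc (suc (suc L))) M
    ≈⟨ detℕ-row₀-two-entries (suc L) M entry-zero ⟩
  varP *P detℕ (suc (suc L)) (withColumn (suc L) (unitColumn x (suc L)) tridiag)
    -P -P oneP *P detℕ (suc (suc L)) (minorℕ M 1)
    ≈⟨ addP-cong (mulP-congʳ varP (detℕ-tridiag-unitColumnLast x (suc L)))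
                 (negP-cong (mulP-congʳ (-P oneP) (detℕ-column₀-top (suc L) (minorℕ M 1) (λ _ → ≋-refl)))) ⟩
  varP *P (x *P pathPoly (suc L)) -P -P oneP *P (-P oneP *P detℕ (suc L) (withColumn L (unitColumn x L) tridiag))
    ≈⟨ addP-cong ≋-refl (negP-cong (mulP-congʳ (-P oneP) (mulP-congʳ (-P oneP) (detℕ-tridiag-unitColumnLast x L)))) ⟩
  varP *P (x *P pathPoly (suc L)) -P -P oneP *P (-P oneP *P (x *P pathPoly L))
    ≈⟨ identity varP x (pathPoly (suc L)) (pathPoly L) ⟩
  x *P (varP *P pathPoly (suc L) -P pathPoly L)
    ≈⟨ mulP-congʳ x (pathPoly-suc-suc L) ⟨
  x *P pathPoly (suc (suc L)) ∎
  where
  open ≋-Reasoning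
  M = withColumn (suc (suc L)) (unitColumn x (suc (suc L))) tridiag
  entry-zero : ∀ j → M 0 (suc (suc j)) ≋ zeroP
  entry-zero j with j ≡ᵇ L
  ... | true  = ≋-refl
  ... | false = ≋-refl
  identity : ∀ t x a b → t *P (x *P a) -P -P oneP *P (-P oneP *P (x *P b)) ≋ x *P (t *P a -P b)
  identity = solve-∀ poly-ring

detℕ-shiftedTridiag : ∀ k → detℕ k shiftedTridiag ≋ signP k oneP
detℕ-shiftedTridiag zero    = ≋-refl
detℕ-shiftedTridiag (suc k) = begin
  detℕ (suc k) shiftedTridiag        ≈⟨ detℕ-column₀-top k shiftedTridiag (λ _ → ≋-refl) ⟩
  -P oneP *P detℕ k shiftedTridiag   ≈⟨ mulP-congʳ (-P oneP) (detℕ-shiftedTridiag k) ⟩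
  -P oneP *P signP k oneP            ≈⟨ identity (signP k oneP) ⟩
  -P signP k oneP                    ≈⟨ signP-suc k oneP ⟨
  signP (suc k) oneP                 ∎
  where
  open ≋-Reasoning
  identity : ∀ a → -P oneP *P a ≋ -P a
  identity = solve-∀ poly-ring

-- Rotating column 0 to the end turns this matrix into withColumn L (unitColumn x L) tridiag.
detℕ-shiftedTridiag-unitColumn₀ : ∀ x L →
  detℕ (suc L) (withColumn 0 (unitColumn x L) shiftedTridiag) ≋ signP L (x *P pathPoly L)
detℕ-shiftedTridiag-unitColumn₀ x L = begin
  detℕ (suc L) M                                 ≈⟨ signP-involutive L _ ⟨
  signP L (signP L (detℕ (suc L) M))             ≈⟨ signP-cong L (detℕ-rotateColumns L M) ⟨
  signP L (detℕ (suc L) (rotateColumns L M))     ≈⟨ signP-cong L (detℕ-tridiag-unitColumnLast x L) ⟩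
  signP L (x *P pathPoly L)                      ∎
  where
  open ≋-Reasoning
  M = withColumn 0 (unitColumn x L) shiftedTridiag

detℕ-shiftedTridiag-+unitColumn₀ : ∀ x L →
  detℕ (suc L) (withColumn 0 (λ r → shiftedTridiag r 0 +P unitColumn x L r) shiftedTridiag)
    ≋ signP (suc L) oneP +P signP L (x *P pathPoly L)
detℕ-shiftedTridiag-+unitColumn₀ x L =
  ≋-trans (detℕ-column₀-linear L (withColumn 0 (λ r → shiftedTridiag r 0 +P unitColumn x L r) shiftedTridiag)
             shiftedTridiag (withColumn 0 (unitColumn x L) shiftedTridiag)
             (λ _ → ≋-refl) (λ _ _ → ≋-refl) (λ _ _ → ≋-refl))
          (addP-cong (detℕ-shiftedTridiag (suc L)) (detℕ-shiftedTridiag-unitColumn₀ x L))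

-- 2 T_{n+2}(λ/2) for the Chebyshev polynomial T of the first kind.
lucasPoly : ℕ → Poly
lucasPoly n = pathPoly (suc (suc n)) -P pathPoly n

two : Poly
two = oneP +P oneP

lucasPoly-double : ∀ n → lucasPoly (suc (suc (n * 2))) +P two ≋ lucasPoly n *P lucasPoly n
lucasPoly-double n = begin
  pathPoly (suc (suc (suc (suc (n * 2))))) -P pathPoly (suc (suc (n * 2))) +P (oneP +P oneP)
    ≈⟨ addP-cong (addP-cong D-high (negP-cong D-low)) (addP-cong cassini cassini) ⟩
  (a *P a -P b *P b) -P (b *P b -P c *P c) +P (e +P e)
    ≈⟨ identity a b c ⟩
  (a -P c) *P (a -P c)
    ∎
  where
  open ≋-Reasoning
  a = pathPoly (suc (suc n))
  b = pathPoly (suc n)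
  c = pathPoly n
  e = b *P b -P a *P c
  cassini : oneP ≋ e
  cassini = ≋-sym (pathPoly-cassini n)
  double : ∀ n → n * 2 ≡ n + n
  double = ℕ-Solver.solve-∀
  double-suc : ∀ n → suc (n * 2) ≡ n + suc n
  double-suc = ℕ-Solver.solve-∀
  D-high : pathPoly (suc (suc (suc (suc (n * 2))))) ≋ a *P a -P b *P b
  D-high = ≋-trans (≡⇒≋ (cong (λ m → pathPoly (suc (suc (suc m)))) (double-suc n)))
                   (pathPoly-+ (suc n) (suc n))
  D-low : pathPoly (suc (suc (n * 2))) ≋ b *P b -P c *P c
  D-low = ≋-trans (≡⇒≋ (cong (λ m → pathPoly (suc (suc m))) (double n))) (pathPoly-+ n n)
  identity : ∀ a b c → (a *P a -P b *P b) -P (b *P b -P c *P c) +P ((b *P b -P a *P c) +P (b *P b -P a *P c))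
                       ≋ (a -P c) *P (a -P c)
  identity = solve-∀ poly-ring

-- Cycles

-- λI − A for the cycle 0 − 1 − ⋯ − L − 0 with A[L][0] = w and A[0][L] = w̄.
cycleCharMatrix : Poly → Poly → ℕ → Matrix
cycleCharMatrix w w̄ L zero    c       = tridiag 0 c -P unitColumn w̄ L c
cycleCharMatrix w w̄ L (suc r) zero    = tridiag (suc r) 0 -P unitColumn w L (suc r)
cycleCharMatrix w w̄ L (suc r) (suc c) = tridiag (suc r) (suc c)

-- Moving the last column to the front, column 0 becomes the path column plus −w̄ e₀;
-- rotating the path part back gives the cycle matrix without the entry w̄.
module _ (w w̄ : Poly) (L′ : ℕ) where

  private
    L : ℕ
    L = suc (suc L′)

    C : Matrix
    C = cycleCharMatrix w w̄ L

    lastColumnFirst : Matrix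
    lastColumnFirst r zero    = C r L
    lastColumnFirst r (suc c) = C r c

    pathPart : Matrix
    pathPart r zero    = tridiag r L
    pathPart r (suc c) = C r c

    cornerPart : Matrix
    cornerPart r (suc c)    = C r c
    cornerPart zero zero    = -P w̄
    cornerPart (suc r) zero = zeroP

    withoutCorner : Matrix
    withoutCorner = rotateColumns L pathPart

  detℕ-lastColumnFirst : detℕ (suc L) C ≋ signP L (detℕ (suc L) lastColumnFirst)
  detℕ-lastColumnFirst = ≋-trans (detℕ-cong′ (suc L) C≋) (detℕ-rotateColumns L lastColumnFirst)
    where
    C≋ : ∀ r c → C r c ≋ rotateColumns L lastColumnFirst r c
    C≋ r c with c ≡ᵇ L in eq
    ... | true  = ≡⇒≋ (cong (C r) (≡ᵇ-true⇒≡ eq))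
    ... | false = ≋-refl

  detℕ-lastColumnFirst-split :
    detℕ (suc L) lastColumnFirst ≋ detℕ (suc L) pathPart +P detℕ (suc L) cornerPart
  detℕ-lastColumnFirst-split =
    detℕ-column₀-linear L lastColumnFirst pathPart cornerPart column₀ (λ _ _ → ≋-refl) (λ _ _ → ≋-refl)
    where
    column₀ : ∀ r → lastColumnFirst r 0 ≋ pathPart r 0 +P cornerPart r 0
    column₀ zero rewrite ≡ᵇ-refl L′ = ≋-refl
    column₀ (suc r) = ≋-sym (addP-identityʳ _)

  detℕ-cornerPart :
    detℕ (suc L) cornerPart ≋ -P w̄ *P (signP L oneP +P signP (suc L′) (-P w *P pathPoly (suc L′)))
  detℕ-cornerPart = ≋-trans (detℕ-column₀-top L cornerPart (λ _ → ≋-refl))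
    (mulP-congʳ (-P w̄) (≋-trans (detℕ-cong′ L minor≋) (detℕ-shiftedTridiag-+unitColumn₀ (-P w) (suc L′))))
    where
    minor≋ : ∀ r c → minorℕ cornerPart 0 r c ≋
      withColumn 0 (λ r → shiftedTridiag r 0 +P unitColumn (-P w) (suc L′) r) shiftedTridiag r c
    minor≋ r zero with r ≡ᵇ suc L′
    ... | true  = ≋-refl
    ... | false = ≋-refl
    minor≋ r (suc c) = ≋-refl

  detℕ-pathPart : detℕ (suc L) pathPart ≋ signP L (detℕ (suc L) withoutCorner)
  detℕ-pathPart = ≋-trans (≋-sym (signP-involutive L _)) (signP-cong L (≋-sym (detℕ-rotateColumns L pathPart)))

  detℕ-withoutCorner :
    detℕ (suc L) withoutCorner ≋ varP *P pathPoly L -P pathPoly (suc L′) -P w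
  detℕ-withoutCorner = begin
    detℕ (suc L) withoutCorner
      ≈⟨ detℕ-row₀-two-entries (suc L′) withoutCorner row₀-zero ⟩
    varP *P detℕ L (minorℕ withoutCorner 0) -P -P oneP *P detℕ L M
      ≈⟨ addP-cong (mulP-congʳ varP (detℕ-cong′ L minor₀≋)) (negP-cong (mulP-congʳ (-P oneP) detℕ-M)) ⟩
    varP *P pathPoly L -P -P oneP *P (-P oneP *P pathPoly (suc L′) -P -P oneP *P -P w)
      ≈⟨ signs varP (pathPoly L) (pathPoly (suc L′)) w ⟩
    varP *P pathPoly L -P pathPoly (suc L′) -P w
      ∎
    where
    open ≋-Reasoning
    M = minorℕ withoutCorner 1

    row₀-zero : ∀ j → withoutCorner 0 (suc (suc j)) ≋ zeroP
    row₀-zero j with j ≡ᵇ L′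
    ... | true  = ≋-refl
    ... | false = ≋-refl

    minor₀≋ : ∀ r c → minorℕ withoutCorner 0 r c ≋ tridiag r c
    minor₀≋ r c = if-≡ᵇ-irrelevant (suc c) L (tridiag (suc r))

    detℕ-M : detℕ L M ≋ -P oneP *P pathPoly (suc L′) -P -P oneP *P -P w
    detℕ-M = ≋-trans (detℕ-row₀-two-entries L′ M (λ j → if-≡ᵇ-irrelevant (suc (suc (suc j))) L (tridiag 1)))
      (addP-cong (mulP-congʳ (-P oneP) (detℕ-cong′ (suc L′) M-minor₀≋))
        (negP-cong (mulP-cong (if-≡ᵇ-irrelevant 2 L (tridiag 1))
          (≋-trans (detℕ-cong′ (suc L′) M-minor₁≋) (detℕ-tridiag-unitColumn₀ (-P w) L′)))))
      where
      M-minor₀≋ : ∀ r c → minorℕ M 0 r c ≋ tridiag r c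
      M-minor₀≋ r c = if-≡ᵇ-irrelevant (suc (suc c)) L (tridiag (suc (suc r)))
      M-minor₁≋ : ∀ r c → minorℕ M 1 r c ≋ withColumn 0 (unitColumn (-P w) L′) tridiag r c
      M-minor₁≋ r zero with r ≡ᵇ L′
      ... | true  = ≋-refl
      ... | false = ≋-refl
      M-minor₁≋ r (suc c) = if-≡ᵇ-irrelevant (suc (suc (suc c))) L (tridiag (suc (suc r)))

    signs : ∀ t a b w → t *P a -P -P oneP *P (-P oneP *P b -P -P oneP *P -P w) ≋ t *P a -P b -P w
    signs = solve-∀ poly-ring

  detℕ-cycleCharMatrix :
    detℕ (suc (suc (suc L′))) (cycleCharMatrix w w̄ (suc (suc L′)))
      ≋ pathPoly (suc (suc (suc L′))) -P w *P w̄ *P pathPoly (suc L′) -P (w +P w̄)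
  detℕ-cycleCharMatrix = begin
    detℕ (suc L) C
      ≈⟨ detℕ-lastColumnFirst ⟩
    signP L (detℕ (suc L) lastColumnFirst)
      ≈⟨ signP-cong L (≋-trans detℕ-lastColumnFirst-split (addP-cong detℕ-pathPart detℕ-cornerPart)) ⟩
    signP L (signP L Y +P -P w̄ *P (σ +P signP (suc L′) (-P w *P D)))
      ≈⟨ signP-+ L (signP L Y) _ ⟩
    signP L (signP L Y) +P signP L (-P w̄ *P (σ +P signP (suc L′) (-P w *P D)))
      ≈⟨ addP-cong (signP-involutive L Y) (signP-≋-mulP L _) ⟩
    Y +P σ *P (-P w̄ *P (σ +P signP (suc L′) (-P w *P D)))
      ≈⟨ addP-cong (≋-refl {Y}) (mulP-congʳ σ (mulP-congʳ (-P w̄) (addP-cong (≋-refl {σ})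
           (≋-trans (signP-suc L′ _) (negP-cong (signP-≋-mulP L′ _)))))) ⟩
    Y +P σ *P (-P w̄ *P (σ +P -P (σ *P (-P w *P D))))
      ≈⟨ factor σ w w̄ D Y ⟩
    Y +P σ *P σ *P -P (w̄ *P (oneP +P w *P D))
      ≈⟨ addP-cong detℕ-withoutCorner (mulP-cong (signP-square L′) ≋-refl) ⟩
    varP *P pathPoly L -P D -P w +P oneP *P -P (w̄ *P (oneP +P w *P D))
      ≈⟨ regroup varP (pathPoly L) D w w̄ ⟩
    (varP *P pathPoly L -P D) -P w *P w̄ *P D -P (w +P w̄)
      ≈⟨ addP-cong (addP-cong (pathPoly-suc-suc (suc L′)) ≋-refl) ≋-refl ⟨
    pathPoly (suc L) -P w *P w̄ *P D -P (w +P w̄)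
      ∎
    where
    open ≋-Reasoning
    Y = detℕ (suc L) withoutCorner
    D = pathPoly (suc L′)
    σ = signP L′ oneP
    factor : ∀ σ w w̄ D Y →
      Y +P σ *P (-P w̄ *P (σ +P -P (σ *P (-P w *P D)))) ≋ Y +P σ *P σ *P -P (w̄ *P (oneP +P w *P D))
    factor = solve-∀ poly-ring
    regroup : ∀ t a D w w̄ →
      t *P a -P D -P w +P oneP *P -P (w̄ *P (oneP +P w *P D)) ≋ (t *P a -P D) -P w *P w̄ *P D -P (w +P w̄)
    regroup = solve-∀ poly-ring

charMatrixℕ : (ℕ → ℕ → ℤi) → Matrix
charMatrixℕ A r c = (if r ≡ᵇ c then varP else zeroP) -P constP (A r c)

charPoly-toℕ : ∀ m (A : ℕ → ℕ → ℤi) → charPoly {m} (λ j k → A (toℕ j) (toℕ k)) ≡ detℕ m (charMatrixℕ A)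
charPoly-toℕ m A = det-toℕ m (charMatrixℕ A)

-- cycleMat m w j k reduces to cycleMatℕ m w (toℕ j) (toℕ k).
cycleMatℕ : ℕ → ℤi → ℕ → ℕ → ℤi
cycleMatℕ m w j k =
  if (k ≡ᵇ suc j) then 1i else
  if (j ≡ᵇ suc k) then 1i else
  if ((j ≡ᵇ (m ∸ 1)) ∧ (k ≡ᵇ 0)) then w else
  if ((j ≡ᵇ 0) ∧ (k ≡ᵇ (m ∸ 1))) then conj w else 0i

constP-adjacency : ∀ b₁ b₂ →
  constP (if b₁ then 1i else if b₂ then 1i else 0i) ≋ (if b₁ then oneP else if b₂ then oneP else zeroP)
constP-adjacency true  b₂    = ≋-refl
constP-adjacency false true  = ≋-refl
constP-adjacency false false = mk≋ λ { zero → refl ; (suc k) → refl }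

charMatrixℕ-cycleMatℕ : ∀ L′ w r c →
  charMatrixℕ (cycleMatℕ (suc (suc (suc L′))) w) r c ≋ cycleCharMatrix (constP w) (constP (conj w)) (suc (suc L′)) r c
charMatrixℕ-cycleMatℕ L′ w zero zero = mk≋ λ { zero → refl ; (suc zero) → refl ; (suc (suc k)) → refl }
charMatrixℕ-cycleMatℕ L′ w zero (suc zero) = ≋-refl
charMatrixℕ-cycleMatℕ L′ w zero (suc (suc c)) with c ≡ᵇ L′
... | true  = ≋-refl
... | false = mk≋ λ { zero → refl ; (suc k) → refl }
charMatrixℕ-cycleMatℕ L′ w (suc zero) zero = ≋-refl
charMatrixℕ-cycleMatℕ L′ w (suc (suc r)) zero with r ≡ᵇ L′
... | true  = ≋-refl
... | false = mk≋ λ { zero → refl ; (suc k) → refl }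
charMatrixℕ-cycleMatℕ L′ w (suc r) (suc c) rewrite ∧-zeroʳ (suc r ≡ᵇ suc (suc L′)) =
  addP-cong (≋-refl {if r ≡ᵇ c then varP else zeroP}) (negP-cong (constP-adjacency (c ≡ᵇ suc r) (r ≡ᵇ suc c)))

constP-*P : ∀ a b → constP a *P constP b ≋ constP (a ⊛ b)
constP-*P a b = mk≋ λ { zero → ⊕-identityʳ (a ⊛ b) ; (suc k) → refl }

charPoly-cycleMat : ∀ L′ w → w ⊛ conj w ≡ 1i →
  charPoly (cycleMat (suc (suc (suc L′))) w) ≋ lucasPoly (suc L′) -P constP (w ⊕ conj w)
charPoly-cycleMat L′ w unimodular = begin
  charPoly (cycleMat (suc (suc (suc L′))) w)
    ≡⟨ charPoly-toℕ (suc (suc (suc L′))) (cycleMatℕ (suc (suc (suc L′))) w) ⟩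
  detℕ (suc (suc (suc L′))) (charMatrixℕ (cycleMatℕ (suc (suc (suc L′))) w))
    ≈⟨ detℕ-cong′ (suc (suc (suc L′))) (charMatrixℕ-cycleMatℕ L′ w) ⟩
  detℕ (suc (suc (suc L′))) (cycleCharMatrix (constP w) (constP (conj w)) (suc (suc L′)))
    ≈⟨ detℕ-cycleCharMatrix (constP w) (constP (conj w)) L′ ⟩
  D₃ -P constP w *P constP (conj w) *P D₁ -P constP (w ⊕ conj w)
    ≈⟨ addP-cong (addP-cong (≋-refl {D₃}) (negP-cong (mulP-cong (constP-*P w (conj w)) (≋-refl {D₁})))) ≋-refl ⟩
  D₃ -P constP (w ⊛ conj w) *P D₁ -P constP (w ⊕ conj w)
    ≡⟨ cong (λ a → D₃ -P constP a *P D₁ -P constP (w ⊕ conj w)) unimodular ⟩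
  D₃ -P oneP *P D₁ -P constP (w ⊕ conj w)
    ≈⟨ addP-cong (addP-cong (≋-refl {D₃}) (negP-cong (mulP-identityˡ D₁))) ≋-refl ⟩
  lucasPoly (suc L′) -P constP (w ⊕ conj w)
    ∎
  where
  open ≋-Reasoning
  D₃ = pathPoly (suc (suc (suc L′)))
  D₁ = pathPoly (suc L′)

-- Checking this conversion under charPoly would make Agda unfold the determinant.
signedCycleNeg≡cycleMat : ∀ k →
  signedCycleNeg (suc (suc (suc k))) ≡ cycleMat (suc (suc (suc (suc (suc (suc (k * 2))))))) (negi 1i)
signedCycleNeg≡cycleMat k = refl

theorem2p3 : (n : ℕ) → 3 ≤ n →
    charPoly (signedCycleNeg n) ≈P mulP (charPoly (mixedCycle1 n)) (charPoly (mixedCycle1 n))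
theorem2p3 (suc (suc (suc k))) (s≤s (s≤s (s≤s _))) = ≋⇒≈P (begin
  charPoly (signedCycleNeg (suc (suc (suc k))))
    ≡⟨ cong charPoly (signedCycleNeg≡cycleMat k) ⟩
  charPoly (cycleMat (suc (suc (suc (suc (suc (suc (k * 2))))))) (negi 1i))
    ≈⟨ charPoly-cycleMat (suc (suc (suc (k * 2)))) (negi 1i) refl ⟩
  lucasPoly (suc (suc (suc k * 2))) -P constP (negi 1i ⊕ conj (negi 1i))
    ≈⟨ addP-cong (≋-refl {lucasPoly (suc (suc (suc k * 2)))}) (mk≋ {q = two} λ { zero → refl ; (suc _) → refl }) ⟩
  lucasPoly (suc (suc (suc k * 2))) +P two
    ≈⟨ lucasPoly-double (suc k) ⟩
  lucasPoly (suc k) *P lucasPoly (suc k)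
    ≈⟨ mulP-cong mixed mixed ⟨
  charPoly (mixedCycle1 (suc (suc (suc k)))) *P charPoly (mixedCycle1 (suc (suc (suc k))))
    ∎)
  where
  open ≋-Reasoning
  mixed : charPoly (mixedCycle1 (suc (suc (suc k)))) ≋ lucasPoly (suc k)
  mixed = ≋-trans (charPoly-cycleMat k iI refl)
    (≋-trans (addP-cong (≋-refl {lucasPoly (suc k)}) (mk≋ {q = zeroP} λ { zero → refl ; (suc _) → refl }))
             (addP-identityʳ (lucasPoly (suc k))))
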